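{- $\mathcal{L}_{qd}$ is expressively complete for all quasi downward closed team properties: $\{\lVert\phi\rVert:\phi\in\mathcal{L}_{qd}\}$ is exactly the set of all quasi downward closed team properties over $\mathbb{P}$.
   Context: Fix a finite set $\mathbb{P}$ of propositional symbols. A valuation is $v:\mathbb{P}\to\{0,1\}$, extended by $v(\top)=1,v(\bot)=0$; a team is a set of valuations; the full team is $\mathbb{F}=2^{\mathbb{P}}$; a team property is a nonempty set of teams. $\lVert\phi\rVert$ is the set of teams satisfying $\phi$. A team property $\mathcal{C}$ is quasi downward closed if $\mathbb{F}\in\mathcal{C}$ and $\mathcal{C}\setminus\{\mathbb{F}\}$ is downward closed (i.e. $T\in\mathcal{C}\setminus\{\mathbb{F}\}$, $S\subseteq T$ imply $S\in\mathcal{C}\setminus\{\mathbb{F}\}$). The logic $\mathcal{L}_{qd}$ has grammar $\phi::=\bullet\mid\mathsf{p}\subseteq^{\bullet}\mathsf{x}\mid\phi\land\phi\mid\phi\lor\phi\mid\phi\sqcup\phi$, where $\mathsf{p}$ is a finite sequence of symbols from $\mathbb{P}$ and $\mathsf{x}$ a sequence of constants $\top,\bot$ with $|\mathsf{p}|=|\mathsf{x}|$. Semantics: $T\models\bullet$ iff $T=\mathbb{F}$; $T\models\mathsf{p}\subseteq^{\bullet}\mathsf{x}$ iff $T=\mathbb{F}$ or for every $v\in T$ there is $v'\in T$ with $v(\mathsf{p})=v'(\mathsf{x})$ (equivalently, every $v\in T$ has $v(\mathsf{p})=v(\mathsf{x})$ componentwise); $\land$ as usual; $T\models\phi\lor\psi$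 iff there are $T_1,T_2\subseteq T$ with $T_1\cup T_2=T$, $T_1\models\phi$, $T_2\models\psi$; $T\models\phi\sqcup\psi$ iff $T\models\phi$ or $T\models\psi$. -}

module Defs where

open import Data.Nat using (ℕ)
open import Data.Fin using (Fin)
open import Data.Bool using (Bool; true; false)
open import Data.Vec using (Vec; lookup; map)
open import Data.Product using (Σ; ∃; _×_)
open import Data.Sum using (_⊎_)
open import Relation.Nullary using (¬_)
open import Relation.Binary.PropositionalEquality using (_≡_)

-- Propositional symbols: ℙ = Fin n.  A valuation ℙ → {0,1} is a Vec Bool n
-- (canonical representation, decidable equality).
Val : ℕ → Set
Val n = Vec Bool n

Team : ℕ → Set
Team n = Val n → Bool

_∈T_ : ∀ {n} → Val n → Team n → Set
v ∈T T = T v ≡ true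

_⊆T_ : ∀ {n} → Team n → Team n → Set
S ⊆T T = ∀ v → v ∈T S → v ∈T T

_≐_ : ∀ {n} → Team n → Team n → Set
S ≐ T = ∀ v → S v ≡ T v

full : ∀ {n} → Team n
full _ = true

IsFull : ∀ {n} → Team n → Set
IsFull T = ∀ v → v ∈T T

data Const : Set where
  ctop cbot : Const

cval : Const → Bool
cval ctop = true
cval cbot = false

valSeq : ∀ {n k} → Val n → Vec (Fin n) k → Vec Bool k
valSeq v p = map (lookup v) p

data Form (n : ℕ) : Set where
  bullet : Form n
  incl   : ∀ {k} → Vec (Fin n) k → Vec Const k → Form n
  _∧ᶠ_   : Form n → Form n → Form n
  _∨ᶠ_   : Form n → Form n → Form n
  _⊔ᶠ_   : Form n → Form n → Form n

_⊨_ : ∀ {n} → Team n → Form n → Set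
T ⊨ bullet = IsFull T
T ⊨ incl p x = IsFull T ⊎
  (∀ v → v ∈T T → ∃ λ v' → v' ∈T T × valSeq v p ≡ map cval x)
T ⊨ (φ ∧ᶠ ψ) = T ⊨ φ × T ⊨ ψ
T ⊨ (φ ∨ᶠ ψ) = Σ (Team _) λ T₁ → Σ (Team _) λ T₂ →
  T₁ ⊆T T × T₂ ⊆T T × (∀ v → v ∈T T → v ∈T T₁ ⊎ v ∈T T₂) × T₁ ⊨ φ × T₂ ⊨ ψ
T ⊨ (φ ⊔ᶠ ψ) = T ⊨ φ ⊎ T ⊨ ψ

QuasiDownClosed : ∀ {n} → (Team n → Set) → Set
QuasiDownClosed {n} 𝒞 =
  𝒞 full × (∀ (T S : Team n) → 𝒞 T → ¬ IsFull T → S ⊆T T → 𝒞 S × ¬ IsFull S)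

-- a Bool-valued team property (a set of teams) must respect equality of teams as sets
RespectsTeamEq : ∀ {n} → (Team n → Bool) → Set
RespectsTeamEq {n} 𝒞 = ∀ (S T : Team n) → S ≐ T → 𝒞 S ≡ 𝒞 T

{-# OPTIONS --safe #-}
-- Every formula holds on the full team 𝔽, and away from 𝔽 every formula is downward
-- closed: atoms are flat, and a split T = T₁ ∪ T₂ witnessing φ ∨ ψ restricts to the
-- split S = (S ∩ T₁) ∪ (S ∩ T₂) of any S ⊆ T.
--
-- Conversely, for a valuation v the atom χ v = (all symbols) ⊆• v(all symbols) pins a
-- team other than 𝔽 down to a subteam of {v}, so the disjunction of χ v over the members
-- of a team T (with a formula holding only on ∅ and 𝔽 for the empty disjunction) defines
-- {S ∣ S ⊆ T} ∪ {𝔽}. A quasi downward closed 𝒞 is then the ⊔ of these formulas over its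
-- members T ≠ 𝔽, together with • for 𝔽.
module Submission where

open import Defs
open import Data.Nat using (ℕ; zero; suc)
open import Data.Bool using (Bool; true; false; _∧_; if_then_else_; _≟_)
open import Data.Bool.Properties using (∧-conicalˡ; ∧-conicalʳ)
open import Data.Fin using (Fin)
import Data.Fin as Fin
open import Data.Vec using (Vec; []; _∷_; allFin; map)
open import Data.Vec.Properties using (map-lookup-allFin; map-∘; map-cong; map-id; ≡-dec)
open import Data.List as List using (List; []; _∷_; filter; cartesianProductWith)
open import Data.List.Membership.Propositional using (_∈_; find; lose)
open import Data.List.Membership.Propositional.Properties
  using (∈-map⁺; ∈-filter⁺; ∈-filter⁻; ∈-cartesianProductWith⁺)
open import Data.List.Relation.Unary.All as All using (all?)
open import Data.List.Relation.Unary.Any using (Any; here; there; any?)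
open import Data.Product using (Σ; ∃; _×_; _,_; proj₁; proj₂)
open import Data.Sum using (_⊎_; inj₁; inj₂)
open import Data.Empty using (⊥-elim)
open import Function.Base using (_∘_; id; case_of_)
open import Function.Bundles using (_⇔_; mk⇔)
open import Level using (Level)
open import Relation.Nullary using (¬_; Dec; yes; no; does; ¬?; _×-dec_)
open import Relation.Nullary.Decidable using (map′; dec-true)
open import Relation.Unary using (Pred; Decidable)
open import Relation.Binary.Definitions using (DecidableEquality)
open import Relation.Binary.PropositionalEquality using (_≡_; refl; sym; trans; cong₂)

private
  variable
    ℓ : Level
    n k : ℕ
    A : Set ℓ
    S T : Team n

_≟ᵥ_ : DecidableEquality (Val n)
_≟ᵥ_ = ≡-dec _≟_

_∈ᵥ?_ : (v : Val n) (vs : List (Val n)) → Dec (v ∈ vs)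
v ∈ᵥ? vs = any? (v ≟ᵥ_) vs

_∈T?_ : (v : Val n) (T : Team n) → Dec (v ∈T T)
v ∈T? T = T v ≟ true

Empty : Team n → Set
Empty S = ∀ v → ¬ v ∈T S

IsFull-⊆ : S ⊆T T → IsFull S → IsFull T
IsFull-⊆ S⊆T S-full v = S⊆T v (S-full v)

_∩_ : Team n → Team n → Team n
(S ∩ T) v = S v ∧ T v

∩-⊆ˡ : (S T : Team n) → (S ∩ T) ⊆T S
∩-⊆ˡ S T v = ∧-conicalˡ (S v) (T v)

∩-⊆ʳ : (S T : Team n) → (S ∩ T) ⊆T T
∩-⊆ʳ S T v = ∧-conicalʳ (S v) (T v)

∈-∩⁺ : (S T : Team n) {v : Val n} → v ∈T S → v ∈T T → v ∈T (S ∩ T)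
∈-∩⁺ S T = cong₂ _∧_

team : {P : Pred (Val n) ℓ} → Decidable P → Team n
team P? v = does (P? v)

∈-team⁺ : {P : Pred (Val n) ℓ} (P? : Decidable P) {v : Val n} → P v → v ∈T team P?
∈-team⁺ P? {v} = dec-true (P? v)

∈-team⁻ : {P : Pred (Val n) ℓ} (P? : Decidable P) {v : Val n} → v ∈T team P? → P v
∈-team⁻ P? {v} v∈P with P? v | v∈P
... | yes p | _ = p
... | no _  | ()

bools : List Bool
bools = true ∷ false ∷ []

∈-bools : (b : Bool) → b ∈ bools
∈-bools true  = here refl
∈-bools false = there (here refl)

valuations : ∀ n → List (Val n)
valuations zero    = [] ∷ []
valuations (suc n) = cartesianProductWith _∷_ bools (valuations n)

∈-valuations : (v : Val n) → v ∈ valuations n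
∈-valuations []      = here refl
∈-valuations (b ∷ v) = ∈-cartesianProductWith⁺ _∷_ (∈-bools b) (∈-valuations v)

full? : (S : Team n) → Dec (IsFull S)
full? {n} S = map′ (λ all v → All.lookup all (∈-valuations v))
                   (λ S-full → All.tabulate (λ {v} _ → S-full v))
                   (all? (_∈T? S) (valuations n))

branch : Team n → Team n → Team (suc n)
branch T₁ T₂ (b ∷ v) = if b then T₁ v else T₂ v

teams : ∀ n → List (Team n)
teams zero    = List.map (λ b _ → b) bools
teams (suc n) = cartesianProductWith branch (teams n) (teams n)

teams-complete : (T : Team n) → ∃ λ T′ → T′ ∈ teams n × T′ ≐ T
teams-complete {zero} T = (λ _ → T []) , ∈-map⁺ (λ b _ → b) (∈-bools (T [])) , λ { [] → refl }
teams-complete {suc n} T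
  with T₁ , T₁∈ , T₁≐ ← teams-complete (T ∘ (true ∷_))
     | T₂ , T₂∈ , T₂≐ ← teams-complete (T ∘ (false ∷_))
  = branch T₁ T₂ , ∈-cartesianProductWith⁺ branch T₁∈ T₂∈ , λ where
      (true ∷ v)  → T₁≐ v
      (false ∷ v) → T₂≐ v

⊨-incl⁺ : ∀ {p : Vec (Fin n) k} {x} →
          (∀ v → v ∈T T → valSeq v p ≡ map cval x) → T ⊨ incl p x
⊨-incl⁺ T-sat = inj₂ λ v v∈T → v , v∈T , T-sat v v∈T

⊨-incl⁻ : ∀ {p : Vec (Fin n) k} {x} →
          ¬ IsFull T → T ⊨ incl p x → ∀ v → v ∈T T → valSeq v p ≡ map cval x
⊨-incl⁻ T≢𝔽 (inj₁ T-full) = ⊥-elim (T≢𝔽 T-full)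
⊨-incl⁻ T≢𝔽 (inj₂ T-sat) v v∈T = proj₂ (proj₂ (T-sat v v∈T))

⊨-full : (φ : Form n) → IsFull S → S ⊨ φ
⊨-full bullet     S-full = S-full
⊨-full (incl p x) S-full = inj₁ S-full
⊨-full (φ ∧ᶠ ψ)   S-full = ⊨-full φ S-full , ⊨-full ψ S-full
⊨-full {S = S} (φ ∨ᶠ ψ) S-full =
  S , S , (λ _ → id) , (λ _ → id) , (λ _ → inj₁) , ⊨-full φ S-full , ⊨-full ψ S-full
⊨-full (φ ⊔ᶠ ψ)   S-full = inj₁ (⊨-full φ S-full)

⊨-downward : (φ : Form n) → S ⊆T T → ¬ IsFull T → T ⊨ φ → S ⊨ φ
⊨-downward bullet S⊆T T≢𝔽 T-full = ⊥-elim (T≢𝔽 T-full)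
⊨-downward (incl p x) S⊆T T≢𝔽 T⊨ = ⊨-incl⁺ λ v v∈S → ⊨-incl⁻ T≢𝔽 T⊨ v (S⊆T v v∈S)
⊨-downward (φ ∧ᶠ ψ) S⊆T T≢𝔽 (T⊨φ , T⊨ψ) =
  ⊨-downward φ S⊆T T≢𝔽 T⊨φ , ⊨-downward ψ S⊆T T≢𝔽 T⊨ψ
⊨-downward {S = S} (φ ∨ᶠ ψ) S⊆T T≢𝔽 (T₁ , T₂ , T₁⊆T , T₂⊆T , cover , T₁⊨φ , T₂⊨ψ) =
  S ∩ T₁ , S ∩ T₂ , ∩-⊆ˡ S T₁ , ∩-⊆ˡ S T₂ , cover′ ,
  ⊨-downward φ (∩-⊆ʳ S T₁) (T≢𝔽 ∘ IsFull-⊆ T₁⊆T) T₁⊨φ ,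
  ⊨-downward ψ (∩-⊆ʳ S T₂) (T≢𝔽 ∘ IsFull-⊆ T₂⊆T) T₂⊨ψ
  where
  cover′ : ∀ v → v ∈T S → v ∈T (S ∩ T₁) ⊎ v ∈T (S ∩ T₂)
  cover′ v v∈S with cover v (S⊆T v v∈S)
  ... | inj₁ v∈T₁ = inj₁ (∈-∩⁺ S T₁ v∈S v∈T₁)
  ... | inj₂ v∈T₂ = inj₂ (∈-∩⁺ S T₂ v∈S v∈T₂)
⊨-downward (φ ⊔ᶠ ψ) S⊆T T≢𝔽 (inj₁ T⊨φ) = inj₁ (⊨-downward φ S⊆T T≢𝔽 T⊨φ)
⊨-downward (φ ⊔ᶠ ψ) S⊆T T≢𝔽 (inj₂ T⊨ψ) = inj₂ (⊨-downward ψ S⊆T T≢𝔽 T⊨ψ)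

quasiDownClosed-⊨ : (φ : Form n) → QuasiDownClosed (λ T → T ⊨ φ)
quasiDownClosed-⊨ φ =
  ⊨-full φ (λ _ → refl) ,
  λ T S T⊨φ T≢𝔽 S⊆T → ⊨-downward φ S⊆T T≢𝔽 T⊨φ , T≢𝔽 ∘ IsFull-⊆ S⊆T

-- With no symbols every team is ∅ or 𝔽; otherwise the first symbol cannot be both ⊤ and ⊥.
emptyᶠ : Form n
emptyᶠ {zero}  = incl [] []
emptyᶠ {suc n} = incl (Fin.zero ∷ []) (ctop ∷ []) ∧ᶠ incl (Fin.zero ∷ []) (cbot ∷ [])

⊨-emptyᶠ⁺ : Empty S → S ⊨ emptyᶠ
⊨-emptyᶠ⁺ {zero}  S-empty = ⊨-incl⁺ λ v v∈S → ⊥-elim (S-empty v v∈S)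
⊨-emptyᶠ⁺ {suc n} S-empty =
  ⊨-incl⁺ (λ v v∈S → ⊥-elim (S-empty v v∈S)) , ⊨-incl⁺ (λ v v∈S → ⊥-elim (S-empty v v∈S))

⊨-emptyᶠ⁻ : ¬ IsFull S → S ⊨ emptyᶠ → Empty S
⊨-emptyᶠ⁻ {zero}  S≢𝔽 _ [] []∈S = S≢𝔽 λ { [] → []∈S }
⊨-emptyᶠ⁻ {suc n} S≢𝔽 (S⊨⊤ , S⊨⊥) (b ∷ v) v∈S
  with ⊨-incl⁻ S≢𝔽 S⊨⊤ (b ∷ v) v∈S | ⊨-incl⁻ S≢𝔽 S⊨⊥ (b ∷ v) v∈S
... | refl | ()

toConst : Bool → Const
toConst true  = ctop
toConst false = cbot

cval-toConst : (b : Bool) → cval (toConst b) ≡ b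
cval-toConst true  = refl
cval-toConst false = refl

map-cval-toConst : (v : Vec Bool k) → map cval (map toConst v) ≡ v
map-cval-toConst v = trans (sym (map-∘ cval toConst v)) (trans (map-cong cval-toConst v) (map-id v))

χ : Val n → Form n
χ {n} v = incl (allFin n) (map toConst v)

⊨-χ⁺ : ∀ {v} → (∀ u → u ∈T S → u ≡ v) → S ⊨ χ v
⊨-χ⁺ {v = v} S⊆v = ⊨-incl⁺ λ u u∈S →
  trans (map-lookup-allFin u) (trans (S⊆v u u∈S) (sym (map-cval-toConst v)))

⊨-χ⁻ : ∀ {v} → ¬ IsFull S → S ⊨ χ v → ∀ u → u ∈T S → u ≡ v
⊨-χ⁻ {v = v} S≢𝔽 S⊨χ u u∈S =
  trans (sym (map-lookup-allFin u)) (trans (⊨-incl⁻ S≢𝔽 S⊨χ u u∈S) (map-cval-toConst v))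

within : List (Val n) → Form n
within []       = emptyᶠ
within (v ∷ vs) = χ v ∨ᶠ within vs

⊨-within⁺ : ∀ {vs} → (∀ u → u ∈T S → u ∈ vs) → S ⊨ within vs
⊨-within⁺ {vs = []} S⊆[] = ⊨-emptyᶠ⁺ λ u u∈S → case S⊆[] u u∈S of λ ()
⊨-within⁺ {S = S} {vs = v ∷ vs} S⊆v∷vs =
  S ∩ V₁ , S ∩ V₂ , ∩-⊆ˡ S V₁ , ∩-⊆ˡ S V₂ , cover ,
  ⊨-χ⁺ (λ u → ∈-team⁻ (_≟ᵥ v) ∘ ∩-⊆ʳ S V₁ u) ,
  ⊨-within⁺ (λ u → ∈-team⁻ (_∈ᵥ? vs) ∘ ∩-⊆ʳ S V₂ u)
  where
  V₁ V₂ : Team _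
  V₁ = team (_≟ᵥ v)
  V₂ = team (_∈ᵥ? vs)
  cover : ∀ u → u ∈T S → u ∈T (S ∩ V₁) ⊎ u ∈T (S ∩ V₂)
  cover u u∈S with S⊆v∷vs u u∈S
  ... | here u≡v   = inj₁ (∈-∩⁺ S V₁ u∈S (∈-team⁺ (_≟ᵥ v) u≡v))
  ... | there u∈vs = inj₂ (∈-∩⁺ S V₂ u∈S (∈-team⁺ (_∈ᵥ? vs) u∈vs))

⊨-within⁻ : ∀ {vs} → ¬ IsFull S → S ⊨ within vs → ∀ u → u ∈T S → u ∈ vs
⊨-within⁻ {vs = []} S≢𝔽 S⊨ u u∈S = ⊥-elim (⊨-emptyᶠ⁻ S≢𝔽 S⊨ u u∈S)
⊨-within⁻ {vs = v ∷ vs} S≢𝔽 (S₁ , S₂ , S₁⊆S , S₂⊆S , cover , S₁⊨ , S₂⊨) u u∈S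
  with cover u u∈S
... | inj₁ u∈S₁ = here (⊨-χ⁻ (S≢𝔽 ∘ IsFull-⊆ S₁⊆S) S₁⊨ u u∈S₁)
... | inj₂ u∈S₂ = there (⊨-within⁻ (S≢𝔽 ∘ IsFull-⊆ S₂⊆S) S₂⊨ u u∈S₂)

below : Team n → Form n
below {n} T = within (filter (_∈T? T) (valuations n))

⊨-below⁺ : S ⊆T T → S ⊨ below T
⊨-below⁺ {T = T} S⊆T = ⊨-within⁺ λ u u∈S → ∈-filter⁺ (_∈T? T) (∈-valuations u) (S⊆T u u∈S)

⊨-below⁻ : ¬ IsFull S → S ⊨ below T → S ⊆T T
⊨-below⁻ {T = T} S≢𝔽 S⊨ u u∈S = proj₂ (∈-filter⁻ (_∈T? T) {xs = valuations _} (⊨-within⁻ S≢𝔽 S⊨ u u∈S))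

⨆ : (A → Form n) → List A → Form n
⨆ f []       = bullet
⨆ f (x ∷ xs) = f x ⊔ᶠ ⨆ f xs

⊨-⨆⁺ : ∀ {f : A → Form n} {xs} → Any (λ x → S ⊨ f x) xs → S ⊨ ⨆ f xs
⊨-⨆⁺ (here S⊨)  = inj₁ S⊨
⊨-⨆⁺ (there S⊨) = inj₂ (⊨-⨆⁺ S⊨)

⊨-⨆⁻ : ∀ {f : A → Form n} {xs} → ¬ IsFull S → S ⊨ ⨆ f xs → Any (λ x → S ⊨ f x) xs
⊨-⨆⁻ {xs = []}     S≢𝔽 S-full    = ⊥-elim (S≢𝔽 S-full)
⊨-⨆⁻ {xs = x ∷ xs} S≢𝔽 (inj₁ S⊨) = here S⊨
⊨-⨆⁻ {xs = x ∷ xs} S≢𝔽 (inj₂ S⊨) = there (⊨-⨆⁻ S≢𝔽 S⊨)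

module _ (𝒞 : Team n → Bool) where

  IsProperMember : Team n → Set
  IsProperMember T = 𝒞 T ≡ true × ¬ IsFull T

  isProperMember? : Decidable IsProperMember
  isProperMember? T = (𝒞 T ≟ true) ×-dec ¬? (full? T)

  express : Form n
  express = ⨆ below (filter isProperMember? (teams n))

  module _ (𝒞-resp : RespectsTeamEq 𝒞)
           (𝒞-qdc : QuasiDownClosed (λ T → 𝒞 T ≡ true)) where

    ⊨-express⁻ : S ⊨ express → 𝒞 S ≡ true
    ⊨-express⁻ {S = S} S⊨ with full? S
    ... | yes S-full = trans (𝒞-resp S full S-full) (proj₁ 𝒞-qdc)
    ... | no S≢𝔽 with T , T∈ , S⊨below ← find (⊨-⨆⁻ S≢𝔽 S⊨)
                   with _ , 𝒞T , T≢𝔽 ← ∈-filter⁻ isProperMember? {xs = teams n} T∈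
      = proj₁ (proj₂ 𝒞-qdc T S 𝒞T T≢𝔽 (⊨-below⁻ S≢𝔽 S⊨below))

    ⊨-express⁺ : 𝒞 S ≡ true → S ⊨ express
    ⊨-express⁺ {S = S} 𝒞S with full? S
    ... | yes S-full = ⊨-full express S-full
    ... | no S≢𝔽 with T , T∈ , T≐S ← teams-complete S
      = ⊨-⨆⁺ (lose (∈-filter⁺ isProperMember? T∈ T-proper) (⊨-below⁺ S⊆T))
      where
      T-proper : IsProperMember T
      T-proper = trans (𝒞-resp T S T≐S) 𝒞S , λ T-full → S≢𝔽 λ v → trans (sym (T≐S v)) (T-full v)
      S⊆T : S ⊆T T
      S⊆T v v∈S = trans (T≐S v) v∈S

mainTheorem13 : (n : ℕ) →
    ((φ : Form n) → QuasiDownClosed (λ T → T ⊨ φ))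
    × ((𝒞 : Team n → Bool) → RespectsTeamEq 𝒞 →
        QuasiDownClosed (λ T → 𝒞 T ≡ true) →
        Σ (Form n) λ φ → (T : Team n) → (T ⊨ φ) ⇔ (𝒞 T ≡ true))
mainTheorem13 n =
  quasiDownClosed-⊨ ,
  λ 𝒞 𝒞-resp 𝒞-qdc →
    express 𝒞 , λ T → mk⇔ (⊨-express⁻ 𝒞 𝒞-resp 𝒞-qdc) (⊨-express⁺ 𝒞 𝒞-resp 𝒞-qdc)
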